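{- Let $k,t,s_1,\dots,s_{t-1},m$ be positive integers with $t\geq 3$, $\frac{k}{t-1}\leq s_i\leq\left\lceil\frac{2k}{t-1}\right\rceil-1$ for every $i\in[t-1]$, and $m\geq 3^{s_1+\dots+s_{t-1}}+1$. Let $K$ be the complete $t$-partite graph with parts of sizes $m,s_1,s_2,\dots,s_{t-1}$. Then $\mathrm{rc}_k(K)\geq 4$.
   Context: Given an edge coloring $c:E(G)\to[\ell]$, a path is rainbow if no two of its edges receive the same color. $(G,c)$ is rainbow $k$-connected if every pair of distinct vertices is joined by $k$ pairwise internally disjoint rainbow paths. The rainbow $k$-connection number $\mathrm{rc}_k(G)$ is the minimum $\ell$ such that some coloring $c:E(G)\to[\ell]$ makes $(G,c)$ rainbow $k$-connected (taken to be $\infty$ if no such coloring exists). -}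

module Defs where

open import Data.Nat using (ℕ; zero; suc; _<_)
open import Data.Fin using (Fin; zero; suc)
open import Data.List using (List; []; _∷_)
open import Data.List.Membership.Propositional using (_∈_)
open import Data.List.Relation.Unary.Unique.Propositional using (Unique)
open import Data.Product using (Σ; _×_; proj₁)
open import Data.Empty using (⊥)
open import Relation.Nullary using (¬_)
open import Relation.Binary.PropositionalEquality using (_≡_; _≢_)

record Graph : Set₁ where
  field
    V   : Set
    Adj : V → V → Set

open Graph public

completeMultipartite : (n : ℕ) → (Fin n → ℕ) → Graph
completeMultipartite n sz = record
  { V   = Σ (Fin n) (λ i → Fin (sz i))
  ; Adj = λ u v → proj₁ u ≢ proj₁ v
  }

-- An edge colouring with colours [ℓ] (= Fin ℓ): a colour for each pair,
-- symmetric on edges (so it is a function on the unordered edges).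
record Coloring (G : Graph) (ℓ : ℕ) : Set where
  field
    col : V G → V G → Fin ℓ
    sym : ∀ u v → Adj G u v → col u v ≡ col v u

open Coloring public

module _ (G : Graph) where

  Chain : List (V G) → Set
  Chain []            = Data.Unit.⊤ where import Data.Unit
  Chain (x ∷ [])      = Data.Unit.⊤ where import Data.Unit
  Chain (x ∷ y ∷ r)   = Adj G x y × Chain (y ∷ r)

  Last : V G → List (V G) → Set
  Last v []          = ⊥
  Last v (x ∷ [])    = x ≡ v
  Last v (x ∷ y ∷ r) = Last v (y ∷ r)

  IsPath : V G → V G → List (V G) → Set
  IsPath u v []      = ⊥
  IsPath u v (x ∷ r) = (x ≡ u) × Last v (x ∷ r) × Unique (x ∷ r) × Chain (x ∷ r)

  edgeColors : ∀ {ℓ} → Coloring G ℓ → List (V G) → List (Fin ℓ)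
  edgeColors c []          = []
  edgeColors c (x ∷ [])    = []
  edgeColors c (x ∷ y ∷ r) = col c x y ∷ edgeColors c (y ∷ r)

  Rainbow : ∀ {ℓ} → Coloring G ℓ → List (V G) → Set
  Rainbow c p = Unique (edgeColors c p)

  dropLast : List (V G) → List (V G)
  dropLast []          = []
  dropLast (x ∷ [])    = []
  dropLast (x ∷ y ∷ r) = x ∷ dropLast (y ∷ r)

  interior : List (V G) → List (V G)
  interior []      = []
  interior (x ∷ r) = dropLast r

  InternallyDisjoint : List (V G) → List (V G) → Set
  InternallyDisjoint p q = ∀ w → w ∈ interior p → w ∈ interior q → ⊥

  RainbowKConnected : ∀ {ℓ} → ℕ → Coloring G ℓ → Set
  RainbowKConnected k c =
    ∀ u v → u ≢ v →
      Σ (Fin k → List (V G)) λ P →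
        (∀ i → IsPath u v (P i) × Rainbow c (P i)) ×
        (∀ i j → i ≢ j → (P i ≢ P j) × InternallyDisjoint (P i) (P j))

  -- rc_k(G) ≥ b : no colouring with fewer than b colours makes G rainbow
  -- k-connected (this also covers rc_k(G) = ∞).
  RcAtLeast : ℕ → ℕ → Set
  RcAtLeast k b = ∀ ℓ → ℓ < b → (c : Coloring G ℓ) → ¬ RainbowKConnected k c

partSizes : (m : ℕ) → {n : ℕ} → (Fin n → ℕ) → Fin (suc n) → ℕ
partSizes m s zero    = m
partSizes m s (suc i) = s i

-- With at most three colours, the colours seen from a vertex of the big part towards the
-- S = s₁ + ⋯ + s_{t-1} other vertices form one of at most 3^S patterns, so two vertices u, v
-- of the big part see the same pattern. A u–v path through one middle vertex w is then never
-- rainbow (c(uw) = c(vw)), and a rainbow path has at most three edges; hence every rainbow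
-- u–v path has exactly two interior vertices, both outside the big part. Internally disjoint
-- paths need 2k such vertices, but S < 2k because (t-1) sᵢ < 2k for every i.
module Submission where

open import Defs renaming (sym to col-sym)
open import Data.Nat using (ℕ; zero; suc; _+_; _*_; _∸_; _^_; _≤_; _<_; z≤n; s≤s; s≤s⁻¹)
open import Data.Nat.Properties
open import Data.Nat.ListAction using (sum)
open import Data.Fin using (Fin; zero; suc; combine; remQuot; inject≤)
import Data.Fin.Properties as Finₚ
open import Data.List using (List; []; _∷_; length; map; _++_; tabulate; allFin; lookup)
open import Data.List.Properties using (length-map; length-++; length-tabulate)
open import Data.List.Membership.Propositional using (_∈_)
open import Data.List.Membership.Propositional.Properties
  using (∈-map⁺; ∈-++⁺ˡ; ∈-++⁺ʳ; ∈-allFin; ∈-lookup)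
open import Data.List.Relation.Unary.All as All using ([]; _∷_)
open import Data.List.Relation.Unary.AllPairs using ([]; _∷_)
open import Data.List.Relation.Unary.Any using (here; there; index)
open import Data.List.Relation.Unary.Any.Properties using (lookup-index)
open import Data.List.Relation.Unary.Unique.Propositional using (Unique)
open import Data.Product using (Σ; ∃₂; _×_; _,_; proj₁; proj₂; uncurry)
open import Data.Sum using (_⊎_; inj₁; inj₂; [_,_]′)
open import Data.Empty using (⊥-elim)
open import Function using (_∘_)
open import Function.Definitions using (Injective)
open import Relation.Nullary using (¬_; yes; no)
open import Relation.Binary.PropositionalEquality

Unique⇒lookup-injective : ∀ {A : Set} {xs : List A} → Unique xs → Injective _≡_ _≡_ (lookup xs)
Unique⇒lookup-injective (_ ∷ _) {zero} {zero} _ = refl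
Unique⇒lookup-injective (x∉xs ∷ _) {zero} {suc j} x≡xsⱼ = ⊥-elim (All.lookup x∉xs (∈-lookup j) x≡xsⱼ)
Unique⇒lookup-injective (x∉xs ∷ _) {suc i} {zero} xsᵢ≡x = ⊥-elim (All.lookup x∉xs (∈-lookup i) (sym xsᵢ≡x))
Unique⇒lookup-injective (_ ∷ unique) {suc i} {suc j} eq = cong suc (Unique⇒lookup-injective unique eq)

Unique⇒length≤ : ∀ {n} {xs : List (Fin n)} → Unique xs → length xs ≤ n
Unique⇒length≤ unique = Finₚ.injective⇒≤ (Unique⇒lookup-injective unique)

injection⇒≤length : ∀ {A : Set} {a} (xs : List A) (f : Fin a → A) →
                    Injective _≡_ _≡_ f → (∀ i → f i ∈ xs) → a ≤ length xs
injection⇒≤length xs f f-injective f∈xs = Finₚ.injective⇒≤ {f = index ∘ f∈xs} index-injective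
  where
  index-injective : Injective _≡_ _≡_ (index ∘ f∈xs)
  index-injective {i} {j} eq = f-injective (begin
    f i                        ≡⟨ lookup-index (f∈xs i) ⟩
    lookup xs (index (f∈xs i)) ≡⟨ cong (lookup xs) eq ⟩
    lookup xs (index (f∈xs j)) ≡⟨ lookup-index (f∈xs j) ⟨
    f j                        ∎)
    where open ≡-Reasoning

remQuot-injective : ∀ {n} k → Injective _≡_ _≡_ (remQuot {n} k)
remQuot-injective {n} k {i} {j} eq = begin
  i                                 ≡⟨ Finₚ.combine-remQuot {n} k i ⟨
  uncurry combine (remQuot {n} k i) ≡⟨ cong (uncurry combine) eq ⟩
  uncurry combine (remQuot {n} k j) ≡⟨ Finₚ.combine-remQuot {n} k j ⟩
  j                                 ∎
  where open ≡-Reasoning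

module _ {A : Set} {b : ℕ} where

  code : (xs : List A) → (A → Fin b) → Fin (b ^ length xs)
  code []       f = zero
  code (x ∷ xs) f = combine (f x) (code xs f)

  code-injective : ∀ xs {f g : A → Fin b} → code xs f ≡ code xs g → ∀ {x} → x ∈ xs → f x ≡ g x
  code-injective (x ∷ xs) {f} {g} eq (here refl) = proj₁ (Finₚ.combine-injective (f x) _ (g x) _ eq)
  code-injective (x ∷ xs) {f} {g} eq (there x∈xs) =
    code-injective xs (proj₂ (Finₚ.combine-injective (f x) _ (g x) _ eq)) x∈xs

  pigeonhole-agree : ∀ {m} (xs : List A) (f : Fin m → A → Fin b) → b ^ length xs < m →
                     ∃₂ λ i j → i ≢ j × (∀ {x} → x ∈ xs → f i x ≡ f j x)
  pigeonhole-agree xs f bound with Finₚ.pigeonhole bound (λ i → code xs (f i))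
  ... | i , j , i<j , eq = i , j , Finₚ.<⇒≢ i<j , code-injective xs eq

sum-tabulate-≤ : ∀ {n b} (f : Fin n → ℕ) → (∀ i → f i ≤ b) → sum (tabulate f) ≤ n * b
sum-tabulate-≤ {zero}  f f≤b = z≤n
sum-tabulate-≤ {suc n} f f≤b = +-mono-≤ (f≤b zero) (sum-tabulate-≤ (f ∘ suc) (f≤b ∘ suc))

sum-tabulate-< : ∀ {n b} (f : Fin (suc n) → ℕ) → (∀ i → f i < b) → sum (tabulate f) < suc n * b
sum-tabulate-< f f<b = +-mono-<-≤ (f<b zero) (sum-tabulate-≤ (f ∘ suc) (<⇒≤ ∘ f<b ∘ suc))

*-sum-tabulate : ∀ {n} a (f : Fin n → ℕ) → a * sum (tabulate f) ≡ sum (tabulate (λ i → a * f i))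
*-sum-tabulate {zero}  a f = *-zeroʳ a
*-sum-tabulate {suc n} a f =
  trans (*-distribˡ-+ a (f zero) _) (cong (a * f zero +_) (*-sum-tabulate a (f ∘ suc)))

shiftΣ : ∀ {n} {s : Fin (suc n) → ℕ} → Σ (Fin n) (λ i → Fin (s (suc i))) → Σ (Fin (suc n)) (λ i → Fin (s i))
shiftΣ (i , x) = suc i , x

allΣ : ∀ {n} (s : Fin n → ℕ) → List (Σ (Fin n) (λ i → Fin (s i)))
allΣ {zero}  s = []
allΣ {suc n} s = map (zero ,_) (allFin (s zero)) ++ map (shiftΣ {s = s}) (allΣ (s ∘ suc))

∈-allΣ : ∀ {n} (s : Fin n → ℕ) i x → (i , x) ∈ allΣ s
∈-allΣ s zero    x = ∈-++⁺ˡ (∈-map⁺ (zero ,_) (∈-allFin x))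
∈-allΣ s (suc i) x = ∈-++⁺ʳ _ (∈-map⁺ (shiftΣ {s = s}) (∈-allΣ (s ∘ suc) i x))

length-allΣ : ∀ {n} (s : Fin n → ℕ) → length (allΣ s) ≡ sum (tabulate s)
length-allΣ {zero}  s = refl
length-allΣ {suc n} s = begin
  length (map (zero ,_) (allFin (s zero)) ++ map (shiftΣ {s = s}) (allΣ (s ∘ suc)))
    ≡⟨ length-++ (map (zero ,_) (allFin (s zero))) ⟩
  length (map (zero ,_) (allFin (s zero))) + length (map (shiftΣ {s = s}) (allΣ (s ∘ suc)))
    ≡⟨ cong₂ _+_ (trans (length-map _ (allFin (s zero))) (length-tabulate {n = s zero} (λ x → x)))
                 (trans (length-map (shiftΣ {s = s}) (allΣ (s ∘ suc))) (length-allΣ (s ∘ suc))) ⟩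
  s zero + sum (tabulate (s ∘ suc)) ∎
  where open ≡-Reasoning

module _ (G : Graph) {ℓ : ℕ} (c : Coloring G ℓ) where

  Twins : V G → V G → Set
  Twins u v = ∀ w → Adj G u w → col c u w ≡ col c v w

  twins-rainbowPath-interior :
    ℓ < 4 → ∀ {u v} → u ≢ v → ¬ Adj G u v → Twins u v →
    ∀ P → IsPath G u v P → Rainbow G c P →
    Unique (interior G P) × length (interior G P) ≡ 2 ×
    (∀ {w} → w ∈ interior G P → Adj G u w ⊎ Adj G w v)
  twins-rainbowPath-interior _ u≢v _ _ (x ∷ []) (refl , x≡v , _) _ = ⊥-elim (u≢v x≡v)
  twins-rainbowPath-interior _ _ u≁v _ (x ∷ y ∷ []) (refl , refl , _ , u~v , _) _ =
    ⊥-elim (u≁v u~v)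
  twins-rainbowPath-interior _ _ _ twins (x ∷ y ∷ z ∷ []) (refl , refl , _ , u~y , y~v , _)
    ((c₁≢c₂ ∷ []) ∷ _) = ⊥-elim (c₁≢c₂ (trans (twins y u~y) (sym (col-sym c y z y~v))))
  twins-rainbowPath-interior _ _ _ _ (x ∷ y ∷ z ∷ w ∷ [])
    (refl , refl , _ ∷ (y≢z ∷ _) ∷ _ , u~y , _ , z~v , _) _ =
    ((y≢z ∷ []) ∷ [] ∷ []) , refl , λ { (here refl) → inj₁ u~y ; (there (here refl)) → inj₂ z~v }
  twins-rainbowPath-interior ℓ<4 _ _ _ (x ∷ y ∷ z ∷ w ∷ a ∷ P) _ rainbow =
    ⊥-elim (<⇒≱ ℓ<4 (≤-trans (m≤m+n 4 _) (Unique⇒length≤ rainbow)))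

disjointInteriors-bound :
  ∀ {G : Graph} {k r} (ws : List (V G)) (P : Fin k → List (V G)) →
  (∀ p q → p ≢ q → InternallyDisjoint G (P p) (P q)) →
  (∀ p → Unique (interior G (P p))) →
  (∀ p → r ≤ length (interior G (P p))) →
  (∀ p {w} → w ∈ interior G (P p) → w ∈ ws) →
  k * r ≤ length ws
disjointInteriors-bound {G} {k} {r} ws P disjoint unique r≤ ⊆ws =
  injection⇒≤length ws vertex vertex-injective vertex∈ws
  where
  interiorVertex : ∀ p → Fin r → V G
  interiorVertex p i = lookup (interior G (P p)) (inject≤ i (r≤ p))

  interiorVertex-injective : ∀ {p q i j} → interiorVertex p i ≡ interiorVertex q j → (p , i) ≡ (q , j)
  interiorVertex-injective {p} {q} eq with p Finₚ.≟ q
  ... | yes refl =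
    cong (p ,_) (Finₚ.inject≤-injective _ _ _ _ (Unique⇒lookup-injective (unique p) eq))
  ... | no p≢q =
    ⊥-elim (disjoint p q p≢q _ (∈-lookup _) (subst (_∈ interior G (P q)) (sym eq) (∈-lookup _)))

  vertex : Fin (k * r) → V G
  vertex = uncurry interiorVertex ∘ remQuot r

  vertex-injective : Injective _≡_ _≡_ vertex
  vertex-injective eq = remQuot-injective r (interiorVertex-injective eq)

  vertex∈ws : ∀ i → vertex i ∈ ws
  vertex∈ws i = ⊆ws (proj₁ (remQuot r i)) (∈-lookup _)

module _ {n : ℕ} (m : ℕ) (s : Fin n → ℕ) where

  private
    G : Graph
    G = completeMultipartite (suc n) (partSizes m s)

  outerVertices : List (V G)
  outerVertices = map (shiftΣ {s = partSizes m s}) (allΣ s)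

  ∈-outerVertices : ∀ {w : V G} → proj₁ w ≢ zero → w ∈ outerVertices
  ∈-outerVertices {zero , x}  w∉0 = ⊥-elim (w∉0 refl)
  ∈-outerVertices {suc i , x} _   = ∈-map⁺ (shiftΣ {s = partSizes m s}) (∈-allΣ s i x)

  length-outerVertices : length outerVertices ≡ sum (tabulate s)
  length-outerVertices = trans (length-map (shiftΣ {s = partSizes m s}) (allΣ s)) (length-allΣ s)

  multipartite-twins : ∀ {ℓ} (c : Coloring G ℓ) → ℓ ≤ 3 → 3 ^ sum (tabulate s) < m →
                       ∃₂ λ i j → i ≢ j × Twins G c (zero , i) (zero , j)
  multipartite-twins c ℓ≤3 3^S<m =
    twinsFrom (pigeonhole-agree outerVertices (λ i → col c (zero , i)) patternBound)
    where
    twinsFrom : (∃₂ λ i j → i ≢ j × (∀ {w} → w ∈ outerVertices → col c (zero , i) w ≡ col c (zero , j) w)) →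
                ∃₂ λ i j → i ≢ j × Twins G c (zero , i) (zero , j)
    twinsFrom (i , j , i≢j , agree) = i , j , i≢j , λ w u~w → agree (∈-outerVertices (≢-sym u~w))

    patternBound : _ ^ length outerVertices < m
    patternBound = ≤-<-trans (^-monoˡ-≤ (length outerVertices) ℓ≤3)
                             (subst (λ S → 3 ^ S < m) (sym length-outerVertices) 3^S<m)

  multipartite-rc≥4 : ∀ k → sum (tabulate s) < 2 * k → 3 ^ sum (tabulate s) < m → RcAtLeast G k 4
  multipartite-rc≥4 k S<2k 3^S<m ℓ ℓ<4 c rkc
    with i , j , i≢j , twins ← multipartite-twins c (s≤s⁻¹ ℓ<4) 3^S<m
    with P , rainbowPaths , distinct ← rkc (zero , i) (zero , j) (λ { refl → i≢j refl })
    = <⇒≱ S<2k (begin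
      2 * k                 ≡⟨ *-comm 2 k ⟩
      k * 2                 ≤⟨ disjointInteriors-bound outerVertices P (λ p q → proj₂ ∘ distinct p q)
                                 (proj₁ ∘ shape) (≤-reflexive ∘ sym ∘ proj₁ ∘ proj₂ ∘ shape)
                                 interior⊆outer ⟩
      length outerVertices  ≡⟨ length-outerVertices ⟩
      sum (tabulate s)      ∎)
    where
    open ≤-Reasoning
    shape : ∀ p → Unique (interior G (P p)) × length (interior G (P p)) ≡ 2 ×
                  (∀ {w} → w ∈ interior G (P p) → Adj G (zero , i) w ⊎ Adj G w (zero , j))
    shape p = twins-rainbowPath-interior G c ℓ<4 (λ { refl → i≢j refl }) (λ u~v → u~v refl) twins
                (P p) (proj₁ (rainbowPaths p)) (proj₂ (rainbowPaths p))

    interior⊆outer : ∀ p {w} → w ∈ interior G (P p) → w ∈ outerVertices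
    interior⊆outer p = [ ∈-outerVertices ∘ ≢-sym , ∈-outerVertices ]′ ∘ proj₂ (proj₂ (shape p))

mainTheorem6 : (k t m : ℕ) → (s : Fin (t ∸ 1) → ℕ) →
    1 ≤ k → 3 ≤ t → 1 ≤ m → (∀ i → 1 ≤ s i) →
    (∀ i → k ≤ (t ∸ 1) * s i) →
    (∀ i → (t ∸ 1) * s i < 2 * k) →
    3 ^ sum (tabulate s) + 1 ≤ m →
    RcAtLeast (completeMultipartite (suc (t ∸ 1)) (partSizes m s)) k 4
mainTheorem6 k t m s _ (s≤s (s≤s (s≤s _))) _ _ _ parts<2k big = multipartite-rc≥4 m s k S<2k 3^S<m
  where
  open ≤-Reasoning
  S<2k : sum (tabulate s) < 2 * k
  S<2k = *-cancelˡ-< (t ∸ 1) _ _ (begin-strict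
    (t ∸ 1) * sum (tabulate s)              ≡⟨ *-sum-tabulate (t ∸ 1) s ⟩
    sum (tabulate (λ i → (t ∸ 1) * s i))    <⟨ sum-tabulate-< _ parts<2k ⟩
    (t ∸ 1) * (2 * k)                       ∎)
  3^S<m : 3 ^ sum (tabulate s) < m
  3^S<m = subst (_≤ m) (+-comm (3 ^ sum (tabulate s)) 1) big
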